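{- Let $T$ be a (left or right) concatenation tree and $\alpha_1,\dots,\alpha_t$ its node labels in RCL order, indices taken modulo $t$. Fix $j$, let $c_j$ be the change index of $\alpha_j=\mathtt{a}_1\cdots\mathtt{a}_n$ and $\beta_1=\mathtt{a}_1\cdots\mathtt{a}_{c_j-1}$. If $\alpha_j$ is not an ancestor of $\alpha_{j+1}$ in $T$, then $\alpha_{j+1}$ has prefix $\beta_1$.
   Context: Strings of length $n$ over $\Sigma=\{0,\dots,k-1\}$. The period of $\alpha$ is $|\beta|$ for the shortest $\beta$ with $\alpha=\beta^q$. A PCR-based cycle-joining tree $\mathcal{T}$ is a rooted tree whose nodes are distinct rotation classes of strings, each named by its lexicographically least rotation (necklace), where the edge from node $u$ to child $v$ is labeled by a conjugate pair $(\mathtt{x}\beta,\mathtt{y}\beta)$ ($\mathtt{x}\neq\mathtt{y}$ symbols, $|\beta|=n-1$) with $\mathtt{x}\beta$ a rotation in $u$ and $\mathtt{y}\beta$ a rotation in $v$; it satisfies the Chain Property if no node has two children with edge labels $(\mathtt{x}\beta,\mathtt{y}\beta)$, $(\mathtt{x}'\beta,\mathtt{y}'\beta)$ sharing $\beta$. A concatenation tree $\mathrm{concat}(\mathcal{T},c,\ell)$, for such $\mathcal{T}$ with the Chain Property, $c\in\{1,\dots,n\}$, $\ell\in\{\mathit{left},\mathit{right}\}$, has the same nodes and parent relation, each node carrying a label (a rotation in its class) and a change index: the root has label its necklace and change index $c$; if a node has label $\alpha$, change index $c'$ and period $p$, with $jp<c'\le jp+p$, its acceptable range is $\{jp+1,\dots,jp+p\}$;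 a child joined by $(\mathtt{x}\beta,\mathtt{y}\beta)$ gets label $\beta_1\mathtt{y}\beta_2$ and change index $|\beta_1|+1$, where $\alpha=\beta_1\mathtt{x}\beta_2$ is the unique factorization with $\beta_2\beta_1=\beta$ and $|\beta_1|+1$ in the acceptable range. Children with change index $<c'$ are left-children, $>c'$ right-children, and $=c'$ left-children if $\ell=\mathit{left}$, right-children if $\ell=\mathit{right}$; each type ordered by increasing change index. RCL order: recursively, the right-children subtrees first to last, then the node, then the left-children subtrees first to last. -}

module Defs where

open import Data.Nat using (ℕ; zero; suc; _+_; _*_; _∸_; _≤_; _<_; _≟_)
open import Data.Nat.DivMod using (_mod_)
open import Data.Fin using (Fin; toℕ) renaming (_<_ to _<F_)
open import Data.List using (List; []; _∷_; _++_; take; drop; length; map; upTo; concat; concatMap; filter; lookup)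
open import Data.List.Relation.Unary.AllPairs using (AllPairs)
open import Data.List.Relation.Unary.Unique.Propositional using (Unique)
open import Data.List.Membership.Propositional using (_∈_)
open import Data.Product using (Σ; ∃; ∃-syntax; _×_; _,_; proj₁; proj₂)
open import Data.Unit using (⊤)
open import Relation.Binary.PropositionalEquality using (_≡_; _≢_)
open import Relation.Nullary using (¬_)

Str : ℕ → Set
Str k = List (Fin k)

rotate : ∀ {A : Set} → ℕ → List A → List A
rotate r xs = drop r xs ++ take r xs

IsRotationOf : ∀ {k} → Str k → Str k → Set
IsRotationOf γ α = ∃[ r ] (r < length α × rotate r α ≡ γ)

data _≤L_ {k : ℕ} : Str k → Str k → Set where
  []≤ : ∀ {ys} → [] ≤L ys
  <∷  : ∀ {x y xs ys} → x <F y → (x ∷ xs) ≤L (y ∷ ys)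
  ≡∷  : ∀ {x xs ys} → xs ≤L ys → (x ∷ xs) ≤L (x ∷ ys)

IsNecklace : ∀ {k} → Str k → Set
IsNecklace α = ∀ r → r < length α → α ≤L rotate r α

pow : ∀ {A : Set} → List A → ℕ → List A
pow β zero    = []
pow β (suc q) = β ++ pow β q

IsPeriod : ∀ {k} → Str k → ℕ → Set
IsPeriod α p =
  (∃[ β ] (length β ≡ p × ∃[ q ] (α ≡ pow β q)))
  × (∀ (β : Str _) q → α ≡ pow β q → p ≤ length β)

-- Left / right concatenation tree
data Side : Set where
  left right : Side

-- Every node carries: the necklace naming its rotation class,
-- a label (used by the concatenation tree) and a change index.
-- Each child carries the conjugate pair (xβ, yβ) labelling the edge
-- (x β is a rotation of the parent, y β a rotation of the child).
mutual
  data CTree (k : ℕ) : Set where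
    node : (neck : Str k) (lab : Str k) (ci : ℕ) (cs : List (Child k)) → CTree k

  data Child (k : ℕ) : Set where
    child : (x y : Fin k) (β : Str k) (t : CTree k) → Child k

neckOf : ∀ {k} → CTree k → Str k
neckOf (node nk _ _ _) = nk

labOf : ∀ {k} → CTree k → Str k
labOf (node _ l _ _) = l

ciOf : ∀ {k} → CTree k → ℕ
ciOf (node _ _ c _) = c

βOf : ∀ {k} → Child k → Str k
βOf (child _ _ β _) = β

mutual
  necks : ∀ {k} → CTree k → List (Str k)
  necks (node nk _ _ cs) = nk ∷ necksF cs

  necksF : ∀ {k} → List (Child k) → List (Str k)
  necksF [] = []
  necksF (child _ _ _ t ∷ cs) = necks t ++ necksF cs

descNecks : ∀ {k} → CTree k → List (Str k)
descNecks (node _ _ _ cs) = necksF cs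

IsAncestor : ∀ {k} → CTree k → CTree k → Set
IsAncestor u v = neckOf v ∈ descNecks u

-- PCR-based cycle-joining tree (for strings of length n) with the
-- Chain Property.  Only the necklace / edge-label data is constrained.

mutual
  PCRNode : ∀ {k} → ℕ → CTree k → Set
  PCRNode n (node nk _ _ cs) =
    length nk ≡ n × IsNecklace nk
    × AllPairs (λ e e' → βOf e ≢ βOf e') cs
    × PCRChildren n nk cs

  PCRChildren : ∀ {k} → ℕ → Str _ → List (Child k) → Set
  PCRChildren n nk [] = ⊤
  PCRChildren n nk (child x y β t ∷ cs) =
    x ≢ y × length β ≡ n ∸ 1
    × IsRotationOf (x ∷ β) nk × IsRotationOf (y ∷ β) (neckOf t)
    × PCRNode n t × PCRChildren n nk cs

PCRTree : ∀ {k} → ℕ → CTree k → Set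
PCRTree n T = PCRNode n T × Unique (necks T)

-- rule for a child joined by (xβ, yβ) to a parent with label α and
-- change index c'; the child has label α' and change index i.
-- i is |β₁|+1 where α = β₁ x β₂, β₂β₁ = β (i.e. rotate (i-1) α = xβ),
-- and i lies in the acceptable range {jp+1,…,jp+p} of the parent.
EdgeRule : ∀ {k} → Str k → ℕ → Fin k → Fin k → Str k → CTree k → Set
EdgeRule α c' x y β (node _ α' i _) =
  ∃[ p ] (IsPeriod α p × ∃[ j ]
    ((j * p < c' × c' ≤ j * p + p)
    × (j * p < i × i ≤ j * p + p)
    × rotate (i ∸ 1) α ≡ x ∷ β
    × α' ≡ take (i ∸ 1) α ++ (y ∷ drop i α)))

mutual
  ConcatNode : ∀ {k} → CTree k → Set
  ConcatNode (node _ α c' cs) = ConcatChildren α c' cs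

  ConcatChildren : ∀ {k} → Str k → ℕ → List (Child k) → Set
  ConcatChildren α c' [] = ⊤
  ConcatChildren α c' (child x y β t ∷ cs) =
    EdgeRule α c' x y β t × ConcatNode t × ConcatChildren α c' cs

IsConcatTree : ∀ {k} → ℕ → CTree k → Set
IsConcatTree c T = labOf T ≡ neckOf T × ciOf T ≡ c × ConcatNode T

range : ℕ → ℕ → List ℕ
range a b = map (a +_) (upTo (suc b ∸ a))

rightIdx : Side → ℕ → ℕ → List ℕ
rightIdx right n c' = range c' n
rightIdx left  n c' = range (suc c') n

leftIdx : Side → ℕ → ℕ → List ℕ
leftIdx left  n c' = range 1 c'
leftIdx right n c' = range 1 (c' ∸ 1)

pick : ∀ {k} → List (ℕ × List (CTree k)) → ℕ → List (CTree k)
pick ps i = concatMap proj₂ (filter (λ p → proj₁ p ≟ i) ps)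

-- RCL order of the nodes (each node given as the subtree rooted at it)
mutual
  rcl : ∀ {k} → ℕ → Side → CTree k → List (CTree k)
  rcl n ℓ t@(node _ _ c' cs) =
    concatMap (pick ps) (rightIdx ℓ n c')
    ++ t ∷ concatMap (pick ps) (leftIdx ℓ n c')
    where ps = rclF n ℓ cs

  rclF : ∀ {k} → ℕ → Side → List (Child k) → List (ℕ × List (CTree k))
  rclF n ℓ [] = []
  rclF n ℓ (child _ _ _ t ∷ cs) = (ciOf t , rcl n ℓ t) ∷ rclF n ℓ cs

next : ∀ {t} → Fin t → Fin t
next {suc m} j = suc (toℕ j) mod suc m

{-# OPTIONS --safe #-}
-- Call a list L of nodes a segment for a string α from lo to hi when every
-- consecutive pair (u, v) with u not an ancestor of v has labels agreeing on the
-- first ciOf u − 1 symbols, the first node agrees with α on the first lo − 1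
-- symbols, and the last node u has ciOf u ≤ hi and agrees with α on its first
-- ciOf u − 1 symbols.  A child joined at change index i copies the first i − 1
-- symbols of its parent's label, and i ≤ |α| because the acceptable range is a
-- block of the period, which divides |α|.  Hence, by induction on the tree, the
-- RCL listing of the subtree of a node with label α and change index c is a
-- segment for α from c to c: the child subtrees are segments for α at their
-- change indices, they are concatenated in increasing order of change index, the
-- node itself (whose label is α) separates the right from the left children, and
-- the first left child is its descendant.  For the whole tree the cyclic pair
-- (last, first) is covered by the two end conditions.

module Submission where

open import Defs
open import Data.Nat using (ℕ; zero; suc; _+_; _*_; _≤_; _<_; _∸_; _≟_; _⊔_; z≤n; s≤s)
open import Data.Nat.Properties
open import Data.Nat.Divisibility using (_∣_; divides)
open import Data.Nat.DivMod using (_%_; n%n≡0; m<n⇒m%n≡m)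
open import Data.Fin using (Fin; toℕ) renaming (zero to fzero; suc to fsuc)
open import Data.Fin.Properties using (toℕ<n; toℕ-fromℕ<)
open import Data.List
  using (List; []; _∷_; length; lookup; take; drop; _++_; concatMap; head; last; applyUpTo)
open import Data.List.Properties
  using (take++drop≡id; take-take; length-++; map-upTo; filter-accept; filter-reject)
open import Data.List.Relation.Unary.All as All using ([]; _∷_)
open import Data.List.Relation.Unary.All.Properties using (++⁺; concat⁺; filter⁺; map⁺)
open import Data.List.Relation.Unary.Any using (here; there)
open import Data.List.Relation.Unary.Linked as Linked using (Linked; []; _∷_)
open import Data.List.Relation.Unary.Linked.Properties as Linkedₚ using ()
open import Data.List.Membership.Propositional using (_∈_)
open import Data.List.Membership.Propositional.Properties using (∈-++⁺ˡ; ∈-++⁺ʳ)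
open import Data.Maybe.Relation.Unary.All as Maybe using (just; nothing)
open import Data.Maybe.Relation.Binary.Connected
  using (Connected; just; just-nothing; nothing-just; nothing)
open import Data.Product using (∃-syntax; _×_; _,_; proj₁; proj₂)
open import Data.Sum using (inj₁; inj₂)
open import Data.Empty using (⊥-elim)
open import Relation.Binary.PropositionalEquality
  using (_≡_; _≢_; refl; sym; trans; cong; subst; module ≡-Reasoning)
open import Relation.Nullary using (¬_; yes; no)

m+[n∸m]≤o : ∀ {m n o} → m ≤ o → n ≤ o → m + (n ∸ m) ≤ o
m+[n∸m]≤o {m} {n} m≤o n≤o with ≤-total m n
... | inj₁ m≤n = ≤-trans (≤-reflexive (m+[n∸m]≡n m≤n)) n≤o
... | inj₂ n≤m rewrite m≤n⇒m∸n≡0 n≤m | +-identityʳ m = m≤o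

next-multiple-≤ : ∀ {p m j} → p ∣ m → j * p < m → j * p + p ≤ m
next-multiple-≤ {p} {m} {j} (divides q refl) jp<qp = begin
  j * p + p  ≡⟨ +-comm (j * p) p ⟩
  suc j * p  ≤⟨ *-monoˡ-≤ p (*-cancelʳ-< p j q jp<qp) ⟩
  q * p      ∎
  where open ≤-Reasoning

toℕ-next-< : ∀ {t} (j : Fin t) → suc (toℕ j) < t → toℕ (next j) ≡ suc (toℕ j)
toℕ-next-< {suc m} j lt = trans (toℕ-fromℕ< _) (m<n⇒m%n≡m lt)

toℕ-next-last : ∀ {t} (j : Fin t) → suc (toℕ j) ≡ t → toℕ (next j) ≡ 0
toℕ-next-last {suc m} j eq = trans (toℕ-fromℕ< _) (trans (cong (_% suc m) eq) (n%n≡0 (suc m)))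

module _ {a} {A : Set a} where

  Agree : ℕ → List A → List A → Set a
  Agree m xs ys = take m xs ≡ take m ys

  Agree-mono : ∀ {m m'} (xs ys : List A) → m ≤ m' → Agree m' xs ys → Agree m xs ys
  Agree-mono {m} {m'} xs ys m≤m' agree = begin
    take m xs                ≡⟨ sym (take-prefix xs) ⟩
    take m (take m' xs)      ≡⟨ cong (take m) agree ⟩
    take m (take m' ys)      ≡⟨ take-prefix ys ⟩
    take m ys                ∎
    where
    open ≡-Reasoning
    take-prefix : ∀ zs → take m (take m' zs) ≡ take m zs
    take-prefix zs = trans (take-take m m' zs) (cong (λ i → take i zs) (m≤n⇒m⊓n≡m m≤m'))

  Agree⇒prefix : ∀ m (xs ys : List A) → Agree m xs ys → ∃[ γ ] (ys ≡ take m xs ++ γ)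
  Agree⇒prefix m xs ys agree =
    drop m ys , trans (sym (take++drop≡id m ys)) (cong (_++ drop m ys) (sym agree))

  take-take++ : ∀ m (xs ys : List A) → m ≤ length xs → take m (take m xs ++ ys) ≡ take m xs
  take-take++ zero    xs       ys _         = refl
  take-take++ (suc m) (x ∷ xs) ys (s≤s m≤) = cong (x ∷_) (take-take++ m xs ys m≤)

  length-take++∷drop : ∀ m (xs : List A) y → m < length xs →
    length (take m xs ++ y ∷ drop (suc m) xs) ≡ length xs
  length-take++∷drop zero    (x ∷ xs) y _         = refl
  length-take++∷drop (suc m) (x ∷ xs) y (s≤s m<) = cong suc (length-take++∷drop m xs y m<)

  last-++-∷ : ∀ xs {y : A} {ys} → last (xs ++ y ∷ ys) ≡ last (y ∷ ys)
  last-++-∷ []            = refl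
  last-++-∷ (x ∷ [])      = refl
  last-++-∷ (x ∷ x' ∷ xs) = last-++-∷ (x' ∷ xs)

  module _ {p} {P : A → Set p} where

    head-++⁺ : ∀ xs {ys} → Maybe.All P (head xs) → Maybe.All P (head ys) →
      Maybe.All P (head (xs ++ ys))
    head-++⁺ []       _ h = h
    head-++⁺ (x ∷ xs) h _ = h

    last-++⁺ : ∀ xs {ys} → Maybe.All P (last xs) → Maybe.All P (last ys) →
      Maybe.All P (last (xs ++ ys))
    last-++⁺ []                     _ l = l
    last-++⁺ (x ∷ [])      {[]}     l _ = l
    last-++⁺ (x ∷ [])      {y ∷ ys} _ l = l
    last-++⁺ (x ∷ x' ∷ xs)          l l' = last-++⁺ (x' ∷ xs) l l'

    last-∷⁺ : ∀ x xs → P x → Maybe.All P (last xs) → Maybe.All P (last (x ∷ xs))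
    last-∷⁺ x []       px _ = just px
    last-∷⁺ x (y ∷ xs) _  l = l

    head-All : ∀ {xs} → All.All P xs → Maybe.All P (head xs)
    head-All []       = nothing
    head-All (px ∷ _) = just px

    lookup-head : ∀ xs → Maybe.All P (head xs) →
      (i : Fin (length xs)) → toℕ i ≡ 0 → P (lookup xs i)
    lookup-head (x ∷ xs) (just px) fzero _ = px

    lookup-last : ∀ xs → Maybe.All P (last xs) →
      (i : Fin (length xs)) → suc (toℕ i) ≡ length xs → P (lookup xs i)
    lookup-last (x ∷ [])     (just px) fzero    _  = px
    lookup-last (x ∷ y ∷ xs) l         (fsuc i) eq = lookup-last (y ∷ xs) l i (suc-injective eq)

  module _ {p q r} {P : A → Set p} {Q : A → Set q} {R : A → A → Set r} where

    connected : (∀ {x y} → P x → Q y → R x y) →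
      ∀ {mx my} → Maybe.All P mx → Maybe.All Q my → Connected R mx my
    connected f (just px) (just qy) = just (f px qy)
    connected f (just _)  nothing   = just-nothing
    connected f nothing   (just _)  = nothing-just
    connected f nothing   nothing   = nothing

  Linked-lookup-suc : ∀ {r} {R : A → A → Set r} {xs} → Linked R xs →
    (i j : Fin (length xs)) → toℕ j ≡ suc (toℕ i) → R (lookup xs i) (lookup xs j)
  Linked-lookup-suc (r ∷ _)  fzero    (fsuc fzero) _  = r
  Linked-lookup-suc (_ ∷ rs) (fsuc i) (fsuc j)     eq = Linked-lookup-suc rs i j (suc-injective eq)

length-pow : ∀ {A : Set} (xs : List A) q → length (pow xs q) ≡ q * length xs
length-pow xs zero    = refl
length-pow xs (suc q) = trans (length-++ xs) (cong (length xs +_) (length-pow xs q))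

module _ {k : ℕ} where

  period∣length : ∀ {α : Str k} {p} → IsPeriod α p → p ∣ length α
  period∣length ((β , refl , q , refl) , _) = divides q (length-pow β q)

  edgeRule-child : ∀ {α : Str k} {c' x y β} t → EdgeRule α c' x y β t → c' ≤ length α →
    ciOf t ≤ length (labOf t) × Agree (ciOf t ∸ 1) (labOf t) α
  edgeRule-child {α} {y = y} (node _ _ (suc i) _)
    (p , period , j , (jp<c' , _) , (_ , i<jp+p) , _ , refl) c'≤ =
    subst (suc i ≤_) (sym (length-take++∷drop i α y i<)) i< ,
    take-take++ i α _ (<⇒≤ i<)
    where
    i< : i < length α
    i< = ≤-trans i<jp+p (next-multiple-≤ {j = j} (period∣length period) (<-≤-trans jp<c' c'≤))

  Step : CTree k → CTree k → Set
  Step u v = ¬ IsAncestor u v → Agree (ciOf u ∸ 1) (labOf u) (labOf v)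

  Opens : Str k → ℕ → CTree k → Set
  Opens α lo v = Agree (lo ∸ 1) (labOf v) α

  Closes : Str k → ℕ → CTree k → Set
  Closes α hi u = ciOf u ≤ hi × Agree (ciOf u ∸ 1) (labOf u) α

  record Segment (α : Str k) (lo hi : ℕ) (L : List (CTree k)) : Set where
    constructor segment
    field
      linked : Linked Step L
      opens  : Maybe.All (Opens α lo) (head L)
      closes : Maybe.All (Closes α hi) (last L)

  Closes⇒Step : ∀ {α mid u v} → Closes α mid u → Opens α mid v → Step u v
  Closes⇒Step {α} {u = u} {v} (ci≤ , agreeᵤ) agreeᵥ _ =
    trans agreeᵤ (sym (Agree-mono (labOf v) α (∸-monoˡ-≤ 1 ci≤) agreeᵥ))

  segment-[] : ∀ {α lo hi} → Segment α lo hi []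
  segment-[] = segment [] nothing nothing

  segment-lower : ∀ {α lo lo' hi L} → lo' ≤ lo → Segment α lo hi L → Segment α lo' hi L
  segment-lower {α} lo'≤ (segment l o c) =
    segment l (Maybe.map (λ {v} → Agree-mono (labOf v) α (∸-monoˡ-≤ 1 lo'≤)) o) c

  segment-raise : ∀ {α lo hi hi' L} → hi ≤ hi' → Segment α lo hi L → Segment α lo hi' L
  segment-raise hi≤ (segment l o c) =
    segment l o (Maybe.map (λ (ci≤ , agree) → ≤-trans ci≤ hi≤ , agree) c)

  segment-++ : ∀ {α lo mid hi L L'} → lo ≤ mid → mid ≤ hi →
    Segment α lo mid L → Segment α mid hi L' → Segment α lo hi (L ++ L')
  segment-++ {L = L} lo≤ ≤hi s@(segment l _ c) s'@(segment l' o' _) =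
    segment (Linkedₚ.++⁺ l (connected (λ {u} {v} → Closes⇒Step {u = u} {v}) c o') l')
            (head-++⁺ L (Segment.opens s) (Segment.opens (segment-lower lo≤ s')))
            (last-++⁺ L (Segment.closes (segment-raise ≤hi s)) (Segment.closes s'))

  segment-++-∷ : ∀ {α lo mid hi L w L'} → labOf w ≡ α →
    Segment α lo mid L → Segment α lo hi (w ∷ L') → Segment α lo hi (L ++ w ∷ L')
  segment-++-∷ {α} {L = L} {w} {L'} refl (segment l o c) (segment l' o' c') =
    segment (Linkedₚ.++⁺ l (connected {Q = _≡ w} (λ { (_ , agree) refl _ → agree }) c (just refl))
                         l')
            (head-++⁺ L o o')
            (subst (Maybe.All (Closes α _)) (sym (last-++-∷ L)) c')

  segment-transport : ∀ {α α' i L} → Agree (i ∸ 1) α' α → Segment α' i i L → Segment α i i L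
  segment-transport {α} {α'} agree (segment l o c) =
    segment l (Maybe.map (λ a → trans a agree) o)
              (Maybe.map (λ (ci≤ , a) → ci≤ , trans a (Agree-mono α' α (∸-monoˡ-≤ 1 ci≤) agree))
                         c)

  Segment⇒cyclic-Step : ∀ {α c} L → Segment α c c L →
    (j : Fin (length L)) → Step (lookup L j) (lookup L (next j))
  Segment⇒cyclic-Step L (segment l o cl) j with m≤n⇒m<n∨m≡n (toℕ<n j)
  ... | inj₁ lt = Linked-lookup-suc l j (next j) (toℕ-next-< j lt)
  ... | inj₂ eq = Closes⇒Step {u = lookup L j} {lookup L (next j)}
                    (lookup-last L cl j eq) (lookup-head L o (next j) (toℕ-next-last j eq))

  ChildSegments : Str k → List (ℕ × List (CTree k)) → Set
  ChildSegments α ps = All.All (λ (i , L) → Segment α i i L) ps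

  pick-accept : ∀ i (L : List (CTree k)) ps → pick ((i , L) ∷ ps) i ≡ L ++ pick ps i
  pick-accept i L ps = cong (concatMap proj₂) (filter-accept (λ e → proj₁ e ≟ i) {i , L} {ps} refl)

  pick-reject : ∀ {i' i} (L : List (CTree k)) ps → i' ≢ i → pick ((i' , L) ∷ ps) i ≡ pick ps i
  pick-reject {i' = i'} {i} L ps i'≢i =
    cong (concatMap proj₂) (filter-reject (λ e → proj₁ e ≟ i) {i' , L} {ps} i'≢i)

  segment-pick : ∀ {α} ps i → ChildSegments α ps → Segment α i i (pick ps i)
  segment-pick []              i []       = segment-[]
  segment-pick {α} ((i' , L) ∷ ps) i (s ∷ ss) with i' ≟ i
  ... | yes refl = subst (Segment α i i) (sym (pick-accept i L ps))
                     (segment-++ ≤-refl ≤-refl s (segment-pick ps i ss))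
  ... | no i'≢i  = subst (Segment α i i) (sym (pick-reject L ps i'≢i)) (segment-pick ps i ss)

  segment-applyUpTo : ∀ {α hi} ps → ChildSegments α ps →
    ∀ m f a → (∀ x → f x ≡ a + x) → a + m ≤ suc hi →
    Segment α a hi (concatMap (pick ps) (applyUpTo f m))
  segment-applyUpTo ps ss zero    f a f≗ a+m≤ = segment-[]
  segment-applyUpTo {α} {hi} ps ss (suc m) f a f≗ a+m≤ =
    segment-++ ≤-refl (≤-trans (m≤m+n a m) (≤-pred a+m≤′)) first (segment-lower (n≤1+n a) rest)
    where
    a+m≤′ : suc a + m ≤ suc hi
    a+m≤′ = subst (_≤ suc hi) (+-suc a m) a+m≤
    first : Segment α a a (pick ps (f 0))
    first = subst (λ i → Segment α i i (pick ps (f 0))) (trans (f≗ 0) (+-identityʳ a))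
                  (segment-pick ps (f 0) ss)
    rest : Segment α (suc a) hi (concatMap (pick ps) (applyUpTo (λ x → f (suc x)) m))
    rest = segment-applyUpTo ps ss m (λ x → f (suc x)) (suc a)
             (λ x → trans (f≗ (suc x)) (+-suc a x)) a+m≤′

  segment-range : ∀ {α hi} ps → ChildSegments α ps → ∀ a b → a ≤ suc hi → b ≤ hi →
    Segment α a hi (concatMap (pick ps) (range a b))
  segment-range {α} {hi} ps ss a b a≤ b≤ =
    subst (λ is → Segment α a hi (concatMap (pick ps) is)) (sym (map-upTo (a +_) (suc b ∸ a)))
      (segment-applyUpTo ps ss (suc b ∸ a) (a +_) a (λ _ → refl) (m+[n∸m]≤o a≤ (s≤s b≤)))

  segment-rightIdx : ∀ {α} n ℓ ps → ChildSegments α ps → ∀ c →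
    Segment α c (c ⊔ n) (concatMap (pick ps) (rightIdx ℓ n c))
  segment-rightIdx n right ps ss c = segment-range ps ss c n (m≤n⇒m≤1+n (m≤m⊔n c n)) (m≤n⊔m c n)
  segment-rightIdx n left  ps ss c =
    segment-lower (n≤1+n c) (segment-range ps ss (suc c) n (s≤s (m≤m⊔n c n)) (m≤n⊔m c n))

  segment-leftIdx : ∀ {α} n ℓ ps → ChildSegments α ps → ∀ c →
    Segment α 1 c (concatMap (pick ps) (leftIdx ℓ n c))
  segment-leftIdx n left  ps ss c = segment-range ps ss 1 c (s≤s z≤n) ≤-refl
  segment-leftIdx n right ps ss c = segment-range ps ss 1 (c ∸ 1) (s≤s z≤n) (m∸n≤m c 1)

  All-pick : ∀ {P : CTree k → Set} ps is →
    All.All (λ e → All.All P (proj₂ e)) ps → All.All P (concatMap (pick ps) is)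
  All-pick ps []       all = []
  All-pick ps (i ∷ is) all = ++⁺ (concat⁺ (map⁺ (filter⁺ _ all))) (All-pick ps is all)

module _ {k : ℕ} (n : ℕ) (ℓ : Side) where

  mutual
    rcl-necks : ∀ (t : CTree k) → All.All (λ b → neckOf b ∈ necks t) (rcl n ℓ t)
    rcl-necks (node _ _ c cs) =
      ++⁺ (All-pick (rclF n ℓ cs) (rightIdx ℓ n c) below)
          (here refl ∷ All-pick (rclF n ℓ cs) (leftIdx ℓ n c) below)
      where
      below = All.map (All.map there) (rclF-necks cs)

    rclF-necks : ∀ (cs : List (Child k)) →
      All.All (λ e → All.All (λ b → neckOf b ∈ necksF cs) (proj₂ e)) (rclF n ℓ cs)
    rclF-necks []                    = []
    rclF-necks (child _ _ _ t ∷ cs) =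
      All.map ∈-++⁺ˡ (rcl-necks t) ∷ All.map (All.map (∈-++⁺ʳ (necks t))) (rclF-necks cs)

  mutual
    rcl-segment : ∀ (t : CTree k) → ConcatNode t → ciOf t ≤ length (labOf t) →
      Segment (labOf t) (ciOf t) (ciOf t) (rcl n ℓ t)
    rcl-segment w@(node _ α c cs) isConcat c≤ =
      segment-++-∷ refl (segment-rightIdx n ℓ ps children c)
                        (segment linkedW (just refl) closesW)
      where
      ps = rclF n ℓ cs
      children = rclF-segments cs isConcat c≤
      Lp = concatMap (pick ps) (leftIdx ℓ n c)
      leftPart = segment-leftIdx n ℓ ps children c
      linkedW : Linked Step (w ∷ Lp)
      linkedW = Linked._∷′_
        (connected {P = _≡ w} (λ { refl below notBelow → ⊥-elim (notBelow below) })
          (just refl) (head-All (All-pick ps (leftIdx ℓ n c) (rclF-necks cs))))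
        (Segment.linked leftPart)
      closesW : Maybe.All (Closes α c) (last (w ∷ Lp))
      closesW = last-∷⁺ w Lp (≤-refl , refl) (Segment.closes leftPart)

    rclF-segments : ∀ {α c} (cs : List (Child k)) → ConcatChildren α c cs → c ≤ length α →
      ChildSegments α (rclF n ℓ cs)
    rclF-segments []                   _                      _  = []
    rclF-segments (child _ _ _ t ∷ cs) (rule , isConcat , rest) c≤ =
      segment-transport (proj₂ edge) (rcl-segment t isConcat (proj₁ edge))
        ∷ rclF-segments cs rest c≤
      where edge = edgeRule-child t rule c≤

lemma1 : ∀ {k n : ℕ} (T : CTree k) (c : ℕ) (ℓ : Side)
    → 1 ≤ c → c ≤ n → PCRTree n T → IsConcatTree c T
    → (j : Fin (length (rcl n ℓ T)))
    → ¬ IsAncestor (lookup (rcl n ℓ T) j) (lookup (rcl n ℓ T) (next j))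
    → ∃[ γ ] (labOf (lookup (rcl n ℓ T) (next j))
               ≡ take (ciOf (lookup (rcl n ℓ T) j) ∸ 1) (labOf (lookup (rcl n ℓ T) j)) ++ γ)
lemma1 {n = n} T@(node _ _ _ _) c ℓ _ c≤n ((refl , _) , _) (refl , refl , isConcat) j notBelow =
  Agree⇒prefix _ _ _
    (Segment⇒cyclic-Step (rcl n ℓ T) (rcl-segment n ℓ T isConcat c≤n) j notBelow)
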